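{- Let $V$ be a finite-dimensional vector space over $\mathbb F_2$ with basis $I$. Let $\Omega$ be an alternating bilinear form on $V$, and let $Q$ be the quadratic form on $V$ with $Q(i)=1$ for all $i\in I$ and $Q(u+v)=Q(u)+Q(v)+\Omega(u,v)$. Let $U\subset V$ be a subspace of codimension one. Then $\dim V_{00}\ge\dim U_{00}-1$.
   Context: For a subspace $W\subseteq V$, $W_0=\{w\in W:\Omega(w,w')=0\text{ for all }w'\in W\}$ is the kernel of the restriction of $\Omega$ to $W$. Also $W_{00}=W_0\cap Q^{ -1}(0)$. (In the paper, $\Omega$ arises from a graph on vertex set $I$ by $\Omega(i,j)=1$ iff $i,j$ are adjacent.) -}

module Defs where

open import Data.Bool using (Bool; true; false; _xor_; _∧_)
open import Data.Nat using (ℕ)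
open import Data.Fin using (Fin; _≟_)
open import Data.Vec using (Vec; zipWith; replicate; tabulate; map; foldr; []; _∷_)
open import Data.Unit using (⊤)
open import Data.Product using (Σ; _×_)
open import Relation.Nullary.Decidable using (⌊_⌋)
open import Relation.Binary.PropositionalEquality using (_≡_)

-- The vector space V = 𝔽₂^I with basis I = Fin n; elements are bit vectors.
V : ℕ → Set
V n = Vec Bool n

_⊕_ : ∀ {n} → V n → V n → V n
u ⊕ v = zipWith _xor_ u v

𝟎 : ∀ {n} → V n
𝟎 {n} = replicate n false

_·_ : ∀ {n} → Bool → V n → V n
c · v = map (c ∧_) v

e : ∀ {n} → Fin n → V n
e i = tabulate (λ j → ⌊ i ≟ j ⌋)

-- Ω is an alternating bilinear form on V (additivity = linearity over 𝔽₂)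
record IsAlternatingBilinear {n : ℕ} (Ω : V n → V n → Bool) : Set where
  field
    additiveˡ   : ∀ u v w → Ω (u ⊕ v) w ≡ Ω u w xor Ω v w
    additiveʳ   : ∀ u v w → Ω u (v ⊕ w) ≡ Ω u v xor Ω u w
    alternating : ∀ v → Ω v v ≡ false

record IsQuadraticFor {n : ℕ} (Ω : V n → V n → Bool) (Q : V n → Bool) : Set where
  field
    onBasis : ∀ i → Q (e i) ≡ true
    polar   : ∀ u v → Q (u ⊕ v) ≡ (Q u xor Q v) xor Ω u v

Subset : ℕ → Set₁
Subset n = V n → Set

record IsSubspace {n : ℕ} (W : Subset n) : Set where
  field
    has-𝟎  : W 𝟎
    closed : ∀ {u v} → W u → W v → W (u ⊕ v)

lincomb : ∀ {n d} → Vec Bool d → Vec (V n) d → V n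
lincomb [] [] = 𝟎
lincomb (c ∷ cs) (b ∷ bs) = (c · b) ⊕ lincomb cs bs

record IsBasis {n d : ℕ} (W : Subset n) (b : Vec (V n) d) : Set where
  field
    inW         : ∀ c → W (lincomb c b)
    independent : ∀ c → lincomb c b ≡ 𝟎 → c ≡ replicate d false
    spanning    : ∀ {w} → W w → Σ (Vec Bool d) (λ c → lincomb c b ≡ w)

HasDim : ∀ {n} → Subset n → ℕ → Set
HasDim {n} W d = Σ (Vec (V n) d) (IsBasis W)

_₀ : ∀ {n} → (V n → V n → Bool) → Subset n → Subset n
(Ω ₀) W w = W w × (∀ w' → W w' → Ω w w' ≡ false)

_,_₀₀ : ∀ {n} → (V n → V n → Bool) → (V n → Bool) → Subset n → Subset n
(Ω , Q ₀₀) W w = (Ω ₀) W w × Q w ≡ false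

Whole : ∀ {n} → Subset n
Whole _ = ⊤

{-# OPTIONS --safe #-}
module Submission where

-- Pick x ∉ U. As U has codimension one, every v lies in U or in U + x, so an element z of U₀₀
-- with Ω(z, x) = 0 is orthogonal to all of V and lies in V₀₀. Thus V₀₀ contains the kernel of
-- the linear functional Ω(-, x) on U₀₀, which has codimension at most one in U₀₀. Dimensions
-- are compared by counting: an injective map 𝔽₂ᵃ → 𝔽₂ᵏ forces 2ᵃ ≤ 2ᵏ.

open import Defs
open import Data.Bool using (Bool; true; false; _xor_; _≟_)
open import Data.Bool.Properties
  using (xor-assoc; xor-comm; xor-identityˡ; xor-identityʳ; xor-same; ∧-distribʳ-xor; ¬-not)
open import Data.Nat using (ℕ; suc; zero; _≤_; _<_; _+_; _^_; s≤s; z≤n)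
open import Data.Nat.Properties
  using (≤-refl; ≤-trans; +-comm; ≮⇒≥; <⇒≱; ^-monoʳ-<; m≤n⇒m≤1+n; n<1+n; 1+n≰n)
open import Data.Fin using (Fin)
open import Data.Fin.Properties using (2↔Bool; *↔×) renaming (injective⇒≤ to Fin-injective⇒≤)
open import Data.Vec using (Vec; []; _∷_; replicate)
open import Data.Vec.Properties
  using (zipWith-assoc; zipWith-comm; zipWith-identityˡ; zipWith-identityʳ; map-id; map-const; ≡-dec)
open import Data.Product using (∃; _×_; _,_; proj₁; proj₂; uncurry)
open import Data.Product.Function.NonDependent.Propositional using (_×-↔_)
open import Data.Sum as Sum using (_⊎_; inj₁; inj₂)
open import Data.Unit using (tt)
open import Function using (_∘_; _↔_; mk↔ₛ′; mk↣; Injection; Injective)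
open import Function.Properties.Inverse using (↔-sym; ↔-trans; ↔⇒↣)
open import Function.Properties.Injection using (↣-trans)
open import Relation.Nullary using (Dec; yes; no; ¬_; contradiction)
open import Relation.Nullary.Decidable using (map′; _⊎-dec_; decidable-stable; ¬?)
open import Relation.Unary using (Decidable)
open import Relation.Binary.PropositionalEquality

private
  variable
    n k a : ℕ

⊕-assoc : (u v w : V n) → (u ⊕ v) ⊕ w ≡ u ⊕ (v ⊕ w)
⊕-assoc = zipWith-assoc xor-assoc

⊕-comm : (u v : V n) → u ⊕ v ≡ v ⊕ u
⊕-comm = zipWith-comm xor-comm

⊕-identityˡ : (v : V n) → 𝟎 ⊕ v ≡ v
⊕-identityˡ = zipWith-identityˡ xor-identityˡ

⊕-identityʳ : (v : V n) → v ⊕ 𝟎 ≡ v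
⊕-identityʳ = zipWith-identityʳ xor-identityʳ

⊕-self : (v : V n) → v ⊕ v ≡ 𝟎
⊕-self []       = refl
⊕-self (x ∷ v) = cong₂ _∷_ (xor-same x) (⊕-self v)

⊕-moveʳ : {u v w : V n} → u ⊕ v ≡ w → u ≡ w ⊕ v
⊕-moveʳ {u = u} {v} {w} eq = begin
  u             ≡⟨ sym (⊕-identityʳ u) ⟩
  u ⊕ 𝟎         ≡⟨ cong (u ⊕_) (sym (⊕-self v)) ⟩
  u ⊕ (v ⊕ v)   ≡⟨ sym (⊕-assoc u v v) ⟩
  (u ⊕ v) ⊕ v   ≡⟨ cong (_⊕ v) eq ⟩
  w ⊕ v         ∎
  where open ≡-Reasoning

·-identity : (v : V n) → true · v ≡ v
·-identity = map-id

·-zero : (v : V n) → false · v ≡ 𝟎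
·-zero v = map-const v false

·-distribʳ : ∀ c c′ (v : V n) → (c xor c′) · v ≡ (c · v) ⊕ (c′ · v)
·-distribʳ c c′ []      = refl
·-distribʳ c c′ (x ∷ v) = cong₂ _∷_ (∧-distribʳ-xor x c c′) (·-distribʳ c c′ v)

⊕-interchange : (u v w z : V n) → (u ⊕ v) ⊕ (w ⊕ z) ≡ (u ⊕ w) ⊕ (v ⊕ z)
⊕-interchange u v w z = begin
  (u ⊕ v) ⊕ (w ⊕ z)   ≡⟨ ⊕-assoc u v (w ⊕ z) ⟩
  u ⊕ (v ⊕ (w ⊕ z))   ≡⟨ cong (u ⊕_) (sym (⊕-assoc v w z)) ⟩
  u ⊕ ((v ⊕ w) ⊕ z)   ≡⟨ cong (λ t → u ⊕ (t ⊕ z)) (⊕-comm v w) ⟩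
  u ⊕ ((w ⊕ v) ⊕ z)   ≡⟨ cong (u ⊕_) (⊕-assoc w v z) ⟩
  u ⊕ (w ⊕ (v ⊕ z))   ≡⟨ sym (⊕-assoc u w (v ⊕ z)) ⟩
  (u ⊕ w) ⊕ (v ⊕ z)   ∎
  where open ≡-Reasoning

lincomb-⊕ : (c c′ : Vec Bool k) (s : Vec (V n) k)
  → lincomb (c ⊕ c′) s ≡ lincomb c s ⊕ lincomb c′ s
lincomb-⊕ []       []         []      = sym (⊕-self 𝟎)
lincomb-⊕ (x ∷ c) (x′ ∷ c′) (v ∷ s) = begin
  ((x xor x′) · v) ⊕ lincomb (c ⊕ c′) s
    ≡⟨ cong₂ _⊕_ (·-distribʳ x x′ v) (lincomb-⊕ c c′ s) ⟩
  ((x · v) ⊕ (x′ · v)) ⊕ (lincomb c s ⊕ lincomb c′ s)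
    ≡⟨ ⊕-interchange _ _ _ _ ⟩
  ((x · v) ⊕ lincomb c s) ⊕ ((x′ · v) ⊕ lincomb c′ s)
    ∎
  where open ≡-Reasoning

lincomb-false∷ : (c : Vec Bool k) (v : V n) (s : Vec (V n) k)
  → lincomb (false ∷ c) (v ∷ s) ≡ lincomb c s
lincomb-false∷ c v s = trans (cong (_⊕ lincomb c s) (·-zero v)) (⊕-identityˡ _)

lincomb-true∷ : (c : Vec Bool k) (v : V n) (s : Vec (V n) k)
  → lincomb (true ∷ c) (v ∷ s) ≡ v ⊕ lincomb c s
lincomb-true∷ c v s = cong (_⊕ lincomb c s) (·-identity v)

Span : Vec (V n) k → Subset n
Span s v = ∃ λ c → lincomb c s ≡ v

Independent : Vec (V n) k → Set
Independent {k = k} s = ∀ c → lincomb c s ≡ 𝟎 → c ≡ replicate k false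

Span-∷⁺ : ∀ {s : Vec (V n) k} {v} y → Span s v → Span (y ∷ s) v
Span-∷⁺ y (c , eq) = false ∷ c , trans (lincomb-false∷ c y _) eq

Span-∷⁻ : ∀ {s : Vec (V n) k} {v} x → Span (x ∷ s) v → Span s v ⊎ Span s (v ⊕ x)
Span-∷⁻ x (false ∷ c , eq) = inj₁ (c , trans (sym (lincomb-false∷ c x _)) eq)
Span-∷⁻ x (true ∷ c , eq)  = inj₂ (c , ⊕-moveʳ (trans (⊕-comm _ x) (trans (sym (lincomb-true∷ c x _)) eq)))

Span-∷-⊕ : ∀ {s : Vec (V n) k} {w} y → Span s (w ⊕ y) → Span (y ∷ s) w
Span-∷-⊕ {s = s} {w} y (c , eq) = true ∷ c , (begin
  lincomb (true ∷ c) (y ∷ s)   ≡⟨ lincomb-true∷ c y s ⟩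
  y ⊕ lincomb c s              ≡⟨ cong (y ⊕_) eq ⟩
  y ⊕ (w ⊕ y)                  ≡⟨ ⊕-comm y (w ⊕ y) ⟩
  (w ⊕ y) ⊕ y                  ≡⟨ sym (⊕-moveʳ refl) ⟩
  w                            ∎)
  where open ≡-Reasoning

lincomb-injective : {s : Vec (V n) k} → Independent s → Injective _≡_ _≡_ (λ c → lincomb c s)
lincomb-injective {s = s} ind {c} {c′} eq = trans (⊕-moveʳ (ind (c ⊕ c′) (begin
  lincomb (c ⊕ c′) s          ≡⟨ lincomb-⊕ c c′ s ⟩
  lincomb c s ⊕ lincomb c′ s  ≡⟨ cong (_⊕ lincomb c′ s) eq ⟩
  lincomb c′ s ⊕ lincomb c′ s ≡⟨ ⊕-self _ ⟩
  𝟎                           ∎))) (⊕-identityˡ c′)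
  where open ≡-Reasoning

∷-independent : {s : Vec (V n) k} {v : V n} → Independent s → ¬ Span s v → Independent (v ∷ s)
∷-independent {s = s} {v} ind _ (false ∷ c) eq =
  cong (false ∷_) (ind c (trans (sym (lincomb-false∷ c v s)) eq))
∷-independent {s = s} {v} ind v∉s (true ∷ c) eq =
  contradiction (c , sym (trans (⊕-moveʳ (trans (sym (lincomb-true∷ c v s)) eq)) (⊕-identityˡ _))) v∉s

∷↔× : {A : Set} → Vec A (suc n) ↔ (A × Vec A n)
∷↔× = mk↔ₛ′ (λ { (x ∷ xs) → x , xs }) (uncurry _∷_) (λ _ → refl) (λ { (x ∷ xs) → refl })

bits↔Fin : ∀ a → Vec Bool a ↔ Fin (2 ^ a)
bits↔Fin zero    = mk↔ₛ′ (λ _ → Fin.zero) (λ _ → [])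
  (λ { Fin.zero → refl ; (Fin.suc ()) }) (λ { [] → refl })
bits↔Fin (suc a) = ↔-trans ∷↔× (↔-trans (↔-sym 2↔Bool ×-↔ bits↔Fin a) (↔-sym *↔×))

2^-cancel-≤ : 2 ^ a ≤ 2 ^ k → a ≤ k
2^-cancel-≤ le = ≮⇒≥ (λ k<a → <⇒≱ (^-monoʳ-< 2 (s≤s (s≤s z≤n)) k<a) le)

bits-injective⇒≤ : (f : Vec Bool a → Vec Bool k) → Injective _≡_ _≡_ f → a ≤ k
bits-injective⇒≤ {a} {k} f f-injective = 2^-cancel-≤ (Fin-injective⇒≤ (Injection.injective
  (↣-trans (↔⇒↣ (↔-sym (bits↔Fin a))) (↣-trans (mk↣ f-injective) (↔⇒↣ (bits↔Fin k))))))

coordinates-injective : {A : Set} {h : A → V n} (s : Vec (V n) k) → Injective _≡_ _≡_ h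
  → (span : ∀ x → Span s (h x)) → Injective _≡_ _≡_ (proj₁ ∘ span)
coordinates-injective {h = h} s h-injective span {x} {y} eq = h-injective (begin
  h x                          ≡⟨ sym (proj₂ (span x)) ⟩
  lincomb (proj₁ (span x)) s   ≡⟨ cong (λ c → lincomb c s) eq ⟩
  lincomb (proj₁ (span y)) s   ≡⟨ proj₂ (span y) ⟩
  h y                          ∎)
  where open ≡-Reasoning

independent⇒≤ : {s : Vec (V n) k} → Independent s → k ≤ n
independent⇒≤ ind = bits-injective⇒≤ _ (lincomb-injective ind)

spanning⇒≤ : (s : Vec (V n) k) → (∀ v → Span s v) → n ≤ k
spanning⇒≤ s span = bits-injective⇒≤ _ (coordinates-injective s (λ eq → eq) span)

independent⊆span⇒≤ : {w : Vec (V n) a} (s : Vec (V n) k) → Independent w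
  → (∀ c → Span s (lincomb c w)) → a ≤ k
independent⊆span⇒≤ s ind span = bits-injective⇒≤ _ (coordinates-injective s (lincomb-injective ind) span)

∃-bits? : ∀ d {P : Vec Bool d → Set} → Decidable P → Dec (∃ P)
∃-bits? zero    P? = map′ ([] ,_) (λ { ([] , p) → p }) (P? [])
∃-bits? (suc d) P? = map′
  Sum.[ (λ (c , p) → false ∷ c , p) , (λ (c , p) → true ∷ c , p) ]
  (λ { (false ∷ c , p) → inj₁ (c , p) ; (true ∷ c , p) → inj₂ (c , p) })
  (∃-bits? d (P? ∘ (false ∷_)) ⊎-dec ∃-bits? d (P? ∘ (true ∷_)))

span? : (s : Vec (V n) k) → Decidable (Span s)
span? s v = ∃-bits? _ (λ c → ≡-dec _≟_ (lincomb c s) v)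

∃∉span : (s : Vec (V n) k) → k < n → ∃ λ x → ¬ Span s x
∃∉span {n = n} s k<n with ∃-bits? n (¬? ∘ span? s)
... | yes x∉s = x∉s
... | no none  = contradiction
  (spanning⇒≤ s (λ v → decidable-stable (span? s v) (λ v∉s → none (v , v∉s)))) (<⇒≱ k<n)

span-split : {s : Vec (V n) k} {x : V n} → n ≤ suc k → Independent s → ¬ Span s x
  → ∀ v → Span s v ⊎ Span s (v ⊕ x)
span-split {n = n} {k = k} {s = s} {x} n≤1+k ind x∉s v with span? s v | span? s (v ⊕ x)
... | yes v∈s | _         = inj₁ v∈s
... | no _    | yes vx∈s  = inj₂ vx∈s
... | no v∉s  | no vx∉s   = contradiction (≤-trans v∷x∷s-length n≤1+k) 1+n≰n
  where
  v∷x∷s-length : suc (suc k) ≤ n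
  v∷x∷s-length = independent⇒≤ {s = v ∷ x ∷ s}
    (∷-independent (∷-independent ind x∉s) (Sum.[ v∉s , vx∉s ] ∘ Span-∷⁻ x))

U₀∩x⊥⊆V₀ : (Ω : V n → V n → Bool) → (∀ u v w → Ω u (v ⊕ w) ≡ Ω u v xor Ω u w)
  → {U : Subset n} {x z : V n} → (∀ v → U v ⊎ U (v ⊕ x))
  → (Ω ₀) U z → Ω z x ≡ false → (Ω ₀) Whole z
U₀∩x⊥⊆V₀ Ω additiveʳ {x = x} {z} split (_ , z⊥U) z⊥x = tt , λ w _ → z⊥ w
  where
  open ≡-Reasoning
  z⊥ : ∀ w → Ω z w ≡ false
  z⊥ w with split w
  ... | inj₁ w∈U  = z⊥U w w∈U
  ... | inj₂ wx∈U = begin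
    Ω z w               ≡⟨ sym (xor-identityʳ _) ⟩
    Ω z w xor false     ≡⟨ cong (Ω z w xor_) (sym z⊥x) ⟩
    Ω z w xor Ω z x     ≡⟨ sym (additiveʳ z w x) ⟩
    Ω z (w ⊕ x)         ≡⟨ z⊥U (w ⊕ x) wx∈U ⟩
    false               ∎

independent⊆kernel+1⇒≤ : {b : Vec (V n) a} (s : Vec (V n) k) (φ : V n → Bool)
  → (∀ u v → φ (u ⊕ v) ≡ φ u xor φ v) → Independent b
  → (∀ c → φ (lincomb c b) ≡ false → Span s (lincomb c b)) → a ≤ suc k
independent⊆kernel+1⇒≤ {b = b} s φ φ-additive ind ker⊆s
  with ∃-bits? _ (λ c → φ (lincomb c b) ≟ true)
... | no φ≡false = m≤n⇒m≤1+n (independent⊆span⇒≤ s ind (λ c → ker⊆s c (¬-not (φ≡false ∘ (c ,_)))))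
... | yes (c₀ , φy≡true) = independent⊆span⇒≤ (lincomb c₀ b ∷ s) ind b⊆span
  where
  open ≡-Reasoning
  y = lincomb c₀ b
  b⊆span : ∀ c → Span (y ∷ s) (lincomb c b)
  b⊆span c with φ (lincomb c b) ≟ true
  ... | no φw≢true   = Span-∷⁺ y (ker⊆s c (¬-not φw≢true))
  ... | yes φw≡true = Span-∷-⊕ y (subst (Span s) (lincomb-⊕ c c₀ b) (ker⊆s (c ⊕ c₀) (begin
    φ (lincomb (c ⊕ c₀) b)      ≡⟨ cong φ (lincomb-⊕ c c₀ b) ⟩
    φ (lincomb c b ⊕ y)         ≡⟨ φ-additive _ _ ⟩
    φ (lincomb c b) xor φ y     ≡⟨ cong₂ _xor_ φw≡true φy≡true ⟩
    false                       ∎)))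

proposition5p4 : (m : ℕ) (Ω : V (suc m) → V (suc m) → Bool) (Q : V (suc m) → Bool)
    → IsAlternatingBilinear Ω → IsQuadraticFor Ω Q
    → (U : Subset (suc m)) → IsSubspace U → HasDim U m
    → (dV dU : ℕ) → HasDim ((Ω , Q ₀₀) Whole) dV → HasDim ((Ω , Q ₀₀) U) dU
    → dU ≤ dV + 1
proposition5p4 m Ω Q isA _ U _ (bU , basU) dV dU (bV , basV) (bW , basW) =
  subst (dU ≤_) (+-comm 1 dV)
    (independent⊆kernel+1⇒≤ bV (λ w → Ω w x) (λ u v → additiveˡ u v x) BW.independent U₀₀∩x⊥⊆V₀₀)
  where
  open IsAlternatingBilinear isA
  module BU = IsBasis basU
  module BV = IsBasis basV
  module BW = IsBasis basW

  x∉span : ∃ λ x → ¬ Span bU x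
  x∉span = ∃∉span bU (n<1+n m)
  x = proj₁ x∉span

  span⊆U : ∀ {v} → Span bU v → U v
  span⊆U (c , eq) = subst U eq (BU.inW c)

  split : ∀ v → U v ⊎ U (v ⊕ x)
  split = Sum.map span⊆U span⊆U ∘ span-split ≤-refl BU.independent (proj₂ x∉span)

  U₀₀∩x⊥⊆V₀₀ : ∀ c → Ω (lincomb c bW) x ≡ false → Span bV (lincomb c bW)
  U₀₀∩x⊥⊆V₀₀ c z⊥x = let (z∈U₀ , Qz≡0) = BW.inW c in
    BV.spanning (U₀∩x⊥⊆V₀ Ω additiveʳ split z∈U₀ z⊥x , Qz≡0)
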